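{- $P_n$ has exactly one matching ordering for $n=1$, exactly three matching orderings for $n=3$ and $n=4$, and exactly two matching orderings for every other $n\ge 2$.
   Context: A tournament has exactly one directed edge between any two distinct vertices. For an ordering $v_1,\dots,v_n$ of the vertex set, a backedge is an edge $v_j\to v_i$ with $j>i$; a matching ordering is an ordering of all vertices in which every vertex is an end of at most one backedge. $P_n$ is the tournament on $v_1,\dots,v_n$ with $v_i\to v_j$ if $j-i\ge2$ and $v_{i+1}\to v_i$ for $1\le i\le n-1$. -}

module Defs where

open import Data.Nat using (ℕ; suc; _+_; _≤_; _<_)
open import Data.Fin using (Fin; toℕ)
open import Data.Vec using (Vec; lookup)
open import Data.List using (List; length)
open import Data.List.Relation.Unary.Unique.Propositional using (Unique)
open import Data.List.Membership.Propositional using (_∈_)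
open import Data.Product using (Σ; ∃; _×_)
open import Data.Sum using (_⊎_)
open import Relation.Binary.PropositionalEquality using (_≡_)
open import Function.Bundles using (_⇔_)

Digraph : ℕ → Set₁
Digraph n = Fin n → Fin n → Set

-- The tournament P_n.  Vertex v_{i+1} of the paper is (i : Fin n).
-- v_i → v_j iff j - i ≥ 2, or i = j + 1 (i.e. v_{j+1} → v_j).
P : (n : ℕ) → Digraph n
P n a b = (toℕ a + 2 ≤ toℕ b) ⊎ (toℕ a ≡ suc (toℕ b))

IsOrdering : {n : ℕ} → Vec (Fin n) n → Set
IsOrdering {n} v =
  (∀ (p q : Fin n) → lookup v p ≡ lookup v q → p ≡ q) ×
  (∀ (x : Fin n) → ∃ λ p → lookup v p ≡ x)

Backedge : {n : ℕ} → Digraph n → Vec (Fin n) n → Fin n → Fin n → Set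
Backedge E v p q = (toℕ p < toℕ q) × E (lookup v q) (lookup v p)

IsEnd : {n : ℕ} → Vec (Fin n) n → Fin n → Fin n → Fin n → Set
IsEnd v x p q = (x ≡ lookup v p) ⊎ (x ≡ lookup v q)

IsMatchingOrdering : {n : ℕ} → Digraph n → Vec (Fin n) n → Set
IsMatchingOrdering {n} E v =
  IsOrdering v ×
  (∀ (x p q p' q' : Fin n) →
     Backedge E v p q → IsEnd v x p q →
     Backedge E v p' q' → IsEnd v x p' q' →
     (p ≡ p') × (q ≡ q'))

HasExactlyMatchingOrderings : {n : ℕ} → Digraph n → ℕ → Set
HasExactlyMatchingOrderings {n} E k =
  Σ (List (Vec (Fin n) n)) λ xs →
    (length xs ≡ k) × Unique xs ×
    (∀ (v : Vec (Fin n) n) → (v ∈ xs) ⇔ IsMatchingOrdering E v)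

-- Number the vertices 0, …, n − 1. In an ordering, x before y is a backedge iff y + 2 ≤ x
-- or y = x + 1. Read a matching ordering from the left: the vertices placed so far are
-- always {0, …, p − 1} or {0, …, p − 2} ∪ {p}, since any other choice of the next vertex
-- makes some vertex the end of two backedges (near the start this uses the vertices 3 and
-- 4, which is why n = 3 and n = 4 are exceptional). So the first vertex, 0 or 1, forces
-- the rest: 0 2 1 4 3 … or 1 0 3 2 …. Conversely, the backedges of these two orderings are
-- pairs {a, a + 1} with a of one fixed parity, so no two of them meet. The cases n = 1, 3, 4
-- are settled by exhaustive search.
module Submission where

open import Defs
open import Data.Nat using (ℕ; zero; suc; pred; _+_; _≤_; _<_; z≤n; s≤s; z<s; _≤?_; _<?_)
import Data.Nat as ℕ
open import Data.Nat.Properties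
  using ( ≤-refl; ≤-reflexive; ≤-trans; ≤-antisym; ≤-pred; <-trans; <-irrefl; ≤-<-trans
        ; n≤1+n; n<1+n; m≤n⇒m≤1+n; m<n⇒m<1+n; pred[n]≤n; n<1⇒n≡0; m≤n⇒m<n∨m≡n
        ; ≤∧≢⇒<; ≮⇒≥; ≤⇒≯; <⇒≱; <⇒≢; 0≢1+n; +-comm)
open import Data.Fin using (Fin; toℕ; fromℕ<; #_)
open import Data.Fin.Properties using (toℕ-injective; toℕ-fromℕ<; toℕ<n; all?; any?)
  renaming (_≟_ to _≟ᶠ_)
open import Data.Vec using (Vec; lookup; tabulate; _∷_; [])
open import Data.Vec.Properties using (lookup∘tabulate; tabulate∘lookup; tabulate-cong; ≡-dec)
open import Data.List using (List; length) renaming (_∷_ to _∷ˡ_; [] to []ˡ)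
open import Data.List.Membership.Propositional using (_∈_)
open import Data.List.Relation.Unary.Any using (here; there)
open import Data.List.Relation.Unary.All using () renaming (_∷_ to _∷ᵃ_; [] to []ᵃ)
open import Data.List.Relation.Unary.AllPairs using () renaming (_∷_ to _∷ᵖ_; [] to []ᵖ)
open import Data.Product using (Σ; ∃; _×_; _,_; proj₁; proj₂)
open import Data.Sum using (_⊎_; inj₁; inj₂)
open import Data.Empty using (⊥; ⊥-elim)
open import Function using (_∘_)
open import Function.Bundles using (_⇔_; mk⇔; Equivalence)
open import Relation.Nullary using (¬_; Dec; yes; no)
open import Relation.Nullary.Decidable using (True; toWitness; map′; _×-dec_; _⊎-dec_; _→-dec_)
open import Relation.Binary.PropositionalEquality
  using (_≡_; _≢_; refl; sym; trans; cong; subst; subst₂; module ≡-Reasoning)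

open Equivalence using (to; from)

private variable
  a b m n p q x y z : ℕ

Edge : ℕ → ℕ → Set
Edge a b = a + 2 ≤ b ⊎ a ≡ suc b

≤-split : m ≤ x → x ≡ m ⊎ suc m ≤ x
≤-split m≤x with m≤n⇒m<n∨m≡n m≤x
... | inj₁ m<x = inj₂ m<x
... | inj₂ m≡x = inj₁ (sym m≡x)

data Dir : Set where
  up down : Dir

private variable
  e : Dir

flip : Dir → Dir
flip up = down
flip down = up

up≢down : up ≢ down
up≢down ()

dir-cases : ∀ e → e ≡ up ⊎ e ≡ down
dir-cases up = inj₁ refl
dir-cases down = inj₂ refl

flip-down : flip e ≡ down → e ≡ up
flip-down {up} _ = refl
flip-down {down} ()

dirAt : Dir → ℕ → Dir
dirAt d zero = d
dirAt d (suc p) = flip (dirAt d p)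

-- Position p of the candidate with initial direction d holds partner n (dirAt d p) p:
-- from direction up the next vertex (p itself at the last position), from down the previous
-- one. Starting down gives 0 2 1 4 3 …, starting up gives 1 0 3 2 ….
partner : ℕ → Dir → ℕ → ℕ
partner n up p with suc p <? n
... | yes _ = suc p
... | no _ = p
partner n down p = pred p

partner-up : suc p < n → partner n up p ≡ suc p
partner-up {p} {n} h with suc p <? n
... | yes _ = refl
... | no h̸ = ⊥-elim (h̸ h)

partner-up-last : ¬ suc p < n → partner n up p ≡ p
partner-up-last {p} {n} h with suc p <? n
... | yes h′ = ⊥-elim (h h′)
... | no _ = refl

partner-< : ∀ e → p < n → partner n e p < n
partner-< {p} {n} up p<n with suc p <? n
... | yes sp<n = sp<n
... | no _ = p<n
partner-< down p<n = ≤-<-trans pred[n]≤n p<n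

module Candidate (n : ℕ) (d : Dir) where

  π : ℕ → ℕ
  π p = partner n (dirAt d p) p

  π-up : ∀ p → dirAt d p ≡ up → suc p < n → π p ≡ suc p
  π-up _ e h = trans (cong (λ e → partner n e _) e) (partner-up h)

  π-up-last : ∀ p → dirAt d p ≡ up → ¬ suc p < n → π p ≡ p
  π-up-last _ e h = trans (cong (λ e → partner n e _) e) (partner-up-last h)

  π-down : ∀ p → dirAt d p ≡ down → π p ≡ pred p
  π-down _ e = cong (λ e → partner n e _) e

  π-< : p < n → π p < n
  π-< {p} = partner-< (dirAt d p)

  π-involutive-up : dirAt d p ≡ up → π (π p) ≡ p
  π-involutive-up {p} e with suc p <? n
  ... | yes sp<n = trans (cong π (π-up p e sp<n)) (π-down (suc p) (cong flip e))
  ... | no sp≮n = trans (cong π (π-up-last p e sp≮n)) (π-up-last p e sp≮n)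

  π-involutive : p < n → π (π p) ≡ p
  π-involutive {p} p<n with dir-cases (dirAt d p)
  ... | inj₁ e = π-involutive-up e
  π-involutive {zero} p<n | inj₂ e = trans (cong π (π-down 0 e)) (π-down 0 e)
  π-involutive {suc p} p<n | inj₂ e = trans (cong π (π-down (suc p) e)) (π-up p (flip-down e) p<n)

  π-≤-suc : ∀ p → π p ≤ suc p
  π-≤-suc p with dir-cases (dirAt d p) | suc p <? n
  ... | inj₁ e | yes sp<n = ≤-reflexive (π-up p e sp<n)
  ... | inj₁ e | no sp≮n = ≤-trans (≤-reflexive (π-up-last p e sp≮n)) (n≤1+n p)
  ... | inj₂ e | _ = ≤-trans (≤-reflexive (π-down p e)) (≤-trans pred[n]≤n (n≤1+n p))

  ≤-π-up : ∀ p → dirAt d p ≡ up → p ≤ π p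
  ≤-π-up p e with suc p <? n
  ... | yes sp<n = ≤-trans (n≤1+n p) (≤-reflexive (sym (π-up p e sp<n)))
  ... | no sp≮n = ≤-reflexive (sym (π-up-last p e sp≮n))

  ≤-suc-π : ∀ p → p ≤ suc (π p)
  ≤-suc-π p with dir-cases (dirAt d p)
  ... | inj₁ e = m≤n⇒m≤1+n (≤-π-up p e)
  ≤-suc-π zero | inj₂ e = z≤n
  ≤-suc-π (suc p) | inj₂ e = ≤-reflexive (cong suc (sym (π-down (suc p) e)))

  backedge-shape : p < q → q < n → Edge (π q) (π p) → π q ≡ suc (π p) × dirAt d (π p) ≡ down
  backedge-shape {p} {q} p<q q<n (inj₁ far) = ⊥-elim (<⇒≱ p<q q≤p)
    where
    q≤p : q ≤ p
    q≤p = ≤-trans (≤-suc-π q)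
            (≤-pred (≤-trans (subst (_≤ π p) (+-comm (π q) 2) far) (π-≤-suc p)))
  backedge-shape {p} {q} p<q q<n (inj₂ adjacent) with dir-cases (dirAt d p)
  ... | inj₁ e = adjacent , trans (cong (dirAt d) (π-up p e (≤-<-trans p<q q<n))) (cong flip e)
  backedge-shape {zero} p<q q<n (inj₂ adjacent) | inj₂ e =
    adjacent , trans (cong (dirAt d) (π-down 0 e)) e
  backedge-shape {suc m} {q} p<q q<n (inj₂ adjacent) | inj₂ e =
    ⊥-elim (<-irrefl refl (≤-<-trans q≤m+1 p<q))
    where
    πq≡m+1 : π q ≡ suc m
    πq≡m+1 = trans adjacent (cong suc (π-down (suc m) e))
    q≡m+2 : q ≡ suc (suc m)
    q≡m+2 = ≤-antisym (≤-trans (≤-suc-π q) (≤-reflexive (cong suc πq≡m+1))) p<q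
    q≤m+1 : q ≤ suc m
    q≤m+1 = ≤-trans (≤-π-up q (trans (cong (dirAt d) q≡m+2) (cong flip e))) (≤-reflexive πq≡m+1)

  π-injective : p < n → q < n → π p ≡ π q → p ≡ q
  π-injective p<n q<n e = trans (sym (π-involutive p<n)) (trans (cong π e) (π-involutive q<n))

  lower-end-unique : dirAt d a ≡ down → dirAt d b ≡ down →
                     x ≡ a ⊎ x ≡ suc a → x ≡ b ⊎ x ≡ suc b → a ≡ b
  lower-end-unique _ _ (inj₁ refl) (inj₁ refl) = refl
  lower-end-unique da db (inj₁ refl) (inj₂ refl) = ⊥-elim (up≢down (trans (sym (flip-down da)) db))
  lower-end-unique da db (inj₂ refl) (inj₁ refl) = ⊥-elim (up≢down (trans (sym (flip-down db)) da))
  lower-end-unique _ _ (inj₂ refl) (inj₂ refl) = refl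

  candidate : Vec (Fin n) n
  candidate = tabulate λ r → fromℕ< (π-< (toℕ<n r))

  private variable
    r s r′ s′ v : Fin n

  toℕ-lookup : ∀ r → toℕ (lookup candidate r) ≡ π (toℕ r)
  toℕ-lookup r = trans (cong toℕ (lookup∘tabulate _ r)) (toℕ-fromℕ< _)

  lookup-injective : lookup candidate r ≡ lookup candidate s → r ≡ s
  lookup-injective {r} {s} e = toℕ-injective (π-injective (toℕ<n r) (toℕ<n s)
    (trans (sym (toℕ-lookup r)) (trans (cong toℕ e) (toℕ-lookup s))))

  lookup-surjective : ∀ v → ∃ λ r → lookup candidate r ≡ v
  lookup-surjective v = w , toℕ-injective (begin
      toℕ (lookup candidate w) ≡⟨ toℕ-lookup w ⟩
      π (toℕ w)                ≡⟨ cong π (toℕ-fromℕ< (π-< (toℕ<n v))) ⟩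
      π (π (toℕ v))            ≡⟨ π-involutive (toℕ<n v) ⟩
      toℕ v                    ∎)
    where
    open ≡-Reasoning
    w = fromℕ< (π-< (toℕ<n v))

  backedge-ends : Backedge (P n) candidate r s →
                  π (toℕ s) ≡ suc (π (toℕ r)) × dirAt d (π (toℕ r)) ≡ down
  backedge-ends {r} {s} (r<s , edge) =
    backedge-shape r<s (toℕ<n s) (subst₂ Edge (toℕ-lookup s) (toℕ-lookup r) edge)

  end-vertex : π (toℕ s) ≡ suc (π (toℕ r)) → IsEnd candidate v r s →
              toℕ v ≡ π (toℕ r) ⊎ toℕ v ≡ suc (π (toℕ r))
  end-vertex {r = r} _ (inj₁ refl) = inj₁ (toℕ-lookup r)
  end-vertex {s} above (inj₂ refl) = inj₂ (trans (toℕ-lookup s) above)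

  backedge-unique-at-end : Backedge (P n) candidate r s → IsEnd candidate v r s →
                           Backedge (P n) candidate r′ s′ → IsEnd candidate v r′ s′ →
                           r ≡ r′ × s ≡ s′
  backedge-unique-at-end {r} {s} {r′ = r′} {s′} b end b′ end′
    with backedge-ends b | backedge-ends b′
  ... | above , lower | above′ , lower′ = r≡r′ , s≡s′
    where
    same-lower : π (toℕ r) ≡ π (toℕ r′)
    same-lower = lower-end-unique lower lower′ (end-vertex above end) (end-vertex above′ end′)
    r≡r′ : r ≡ r′
    r≡r′ = toℕ-injective (π-injective (toℕ<n r) (toℕ<n r′) same-lower)
    s≡s′ : s ≡ s′
    s≡s′ = toℕ-injective (π-injective (toℕ<n s) (toℕ<n s′)
             (trans above (trans (cong suc same-lower) (sym above′))))

  candidate-isMatchingOrdering : IsMatchingOrdering (P n) candidate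
  candidate-isMatchingOrdering =
    ((λ r s → lookup-injective) , lookup-surjective) , λ v r s r′ s′ → backedge-unique-at-end

open Candidate using (candidate; candidate-isMatchingOrdering)

-- The vertices at the first p positions of a candidate whose position p has direction e.
Placed : Dir → ℕ → ℕ → Set
Placed down (suc m) y = y < m ⊎ y ≡ suc m
Placed up p y = y < p
Placed down zero y = y < 0

placed-step : ∀ e → suc p < n → Placed e p y ⊎ y ≡ partner n e p → Placed (flip e) (suc p) y
placed-step up sp<n (inj₁ y<p) = inj₁ y<p
placed-step up sp<n (inj₂ refl) = inj₂ (partner-up sp<n)
placed-step {zero} down _ (inj₂ refl) = z<s
placed-step {suc m} down _ (inj₁ (inj₁ y<m)) = <-trans y<m (<-trans (n<1+n m) (n<1+n (suc m)))
placed-step {suc m} down _ (inj₁ (inj₂ refl)) = n<1+n (suc m)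
placed-step {suc m} down _ (inj₂ refl) = <-trans (n<1+n m) (n<1+n (suc m))

placed-step⁻ : ∀ e → suc p < n → Placed (flip e) (suc p) y → Placed e p y ⊎ y ≡ partner n e p
placed-step⁻ up _ (inj₁ y<p) = inj₁ y<p
placed-step⁻ up sp<n (inj₂ refl) = inj₂ (sym (partner-up sp<n))
placed-step⁻ {zero} down _ y<1 = inj₂ (n<1⇒n≡0 y<1)
placed-step⁻ {suc m} down _ y<m+2 with m≤n⇒m<n∨m≡n (≤-pred y<m+2)
... | inj₂ refl = inj₁ (inj₂ refl)
... | inj₁ y<m+1 with m≤n⇒m<n∨m≡n (≤-pred y<m+1)
...   | inj₂ refl = inj₂ refl
...   | inj₁ y<m = inj₁ (inj₁ y<m)

module Rigidity {n : ℕ} (v : Vec (Fin n) n) (mo : IsMatchingOrdering (P n) v) where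

  private variable
    r s t i : Fin n
    S T : ℕ → Set

  vertexAt : Fin n → ℕ
  vertexAt r = toℕ (lookup v r)

  vertexAt-injective : vertexAt r ≡ vertexAt s → r ≡ s
  vertexAt-injective {r} {s} e = proj₁ (proj₁ mo) r s (toℕ-injective e)

  position : y < n → Σ (Fin n) λ r → vertexAt r ≡ y
  position y<n with proj₂ (proj₁ mo) (fromℕ< y<n)
  ... | r , e = r , trans (cong toℕ e) (toℕ-fromℕ< y<n)

  Linked : Fin n → Fin n → Set
  Linked r s = Backedge (P n) v r s ⊎ Backedge (P n) v s r

  linked-unique : Linked r s → Linked r t → s ≡ t
  linked-unique {r} {s} {t} (inj₁ b) (inj₁ b′) =
    proj₂ (proj₂ mo (lookup v r) r s r t b (inj₁ refl) b′ (inj₁ refl))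
  linked-unique {r} {s} {t} (inj₁ b) (inj₂ b′)
    with proj₂ mo (lookup v r) r s t r b (inj₁ refl) b′ (inj₂ refl)
  ... | r≡t , s≡r = trans s≡r r≡t
  linked-unique {r} {s} {t} (inj₂ b) (inj₁ b′)
    with proj₂ mo (lookup v r) s r r t b (inj₂ refl) b′ (inj₁ refl)
  ... | s≡r , r≡t = trans s≡r r≡t
  linked-unique {r} {s} {t} (inj₂ b) (inj₂ b′) =
    proj₁ (proj₂ mo (lookup v r) s r t r b (inj₂ refl) b′ (inj₂ refl))

  infix 4 _≺_
  _≺_ : ℕ → ℕ → Set
  x ≺ y = Σ (Fin n) λ r → Σ (Fin n) λ s → vertexAt r ≡ x × vertexAt s ≡ y × toℕ r < toℕ s

  ≺-trans : x ≺ y → y ≺ z → x ≺ z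
  ≺-trans (r , s , refl , refl , r<s) (s′ , t , e , refl , s′<t) with vertexAt-injective e
  ... | refl = r , t , refl , refl , <-trans r<s s′<t

  Backward : ℕ → ℕ → Set
  Backward x y = x ≺ y × Edge y x

  Partners : ℕ → ℕ → Set
  Partners x y = Backward x y ⊎ Backward y x

  partners-linked : Partners x y →
                    Σ (Fin n) λ r → Σ (Fin n) λ s → vertexAt r ≡ x × vertexAt s ≡ y × Linked r s
  partners-linked (inj₁ ((r , s , refl , refl , r<s) , edge)) =
    r , s , refl , refl , inj₁ (r<s , edge)
  partners-linked (inj₂ ((s , r , refl , refl , s<r) , edge)) =
    r , s , refl , refl , inj₂ (s<r , edge)

  partners-unique : Partners x y → Partners x z → y ≡ z
  partners-unique p q with partners-linked p | partners-linked q
  ... | r , s , refl , refl , l | r′ , t , e , refl , l′ with vertexAt-injective e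
  ... | refl = cong vertexAt (linked-unique l l′)

  no-ascending-triple : a ≺ suc a → suc a ≺ suc (suc a) → ⊥
  no-ascending-triple {a} a≺ ≺a+2 = <-irrefl a≡a+2 (<-trans (n<1+n a) (n<1+n (suc a)))
    where
    a≡a+2 : a ≡ suc (suc a)
    a≡a+2 = partners-unique (inj₂ (a≺ , inj₂ refl)) (inj₁ (≺a+2 , inj₂ refl))

  no-far-vertex-between : a ≺ x → x ≺ suc a → 3 + a ≤ x → ⊥
  no-far-vertex-between {a} {x} a≺x x≺a+1 a+3≤x = <-irrefl a≡x a<x
    where
    a<x : a < x
    a<x = ≤-trans (n≤1+n (suc a)) (≤-trans (n≤1+n _) a+3≤x)
    a≡x : a ≡ x
    a≡x = partners-unique (inj₂ (≺-trans a≺x x≺a+1 , inj₂ refl))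
                          (inj₂ (x≺a+1 , inj₁ (subst (_≤ x) (+-comm 2 (suc a)) a+3≤x)))

  Prefix : (ℕ → Set) → ℕ → Set
  Prefix S p = ∀ r → toℕ r < p ⇔ S (vertexAt r)

  prefix-resp : (∀ {y} → S y → T y) → (∀ {y} → T y → S y) → Prefix S p → Prefix T p
  prefix-resp f g pre r = mk⇔ (f ∘ to (pre r)) (from (pre r) ∘ g)

  empty-prefix : ∀ e → Prefix (Placed e 0) 0
  empty-prefix up r = mk⇔ (λ ()) (λ ())
  empty-prefix down r = mk⇔ (λ ()) (λ ())

  extend : Prefix S p → toℕ i ≡ p → vertexAt i ≡ x → Prefix (λ y → S y ⊎ y ≡ x) (suc p)
  extend {S} {p} {i} {x} pre i≡p refl r = mk⇔ forward backward
    where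
    forward : toℕ r < suc p → S (vertexAt r) ⊎ vertexAt r ≡ vertexAt i
    forward r<p+1 with m≤n⇒m<n∨m≡n (≤-pred r<p+1)
    ... | inj₁ r<p = inj₁ (to (pre r) r<p)
    ... | inj₂ r≡p = inj₂ (cong vertexAt (toℕ-injective (trans r≡p (sym i≡p))))
    backward : S (vertexAt r) ⊎ vertexAt r ≡ vertexAt i → toℕ r < suc p
    backward (inj₁ placed) = m<n⇒m<1+n (from (pre r) placed)
    backward (inj₂ e) = ≤-reflexive (cong suc (trans (cong toℕ (vertexAt-injective e)) i≡p))

  record Next (S : ℕ → Set) (x : ℕ) : Set where
    field
      bounded : x < n
      fresh : ¬ S x
      before : ∀ {y} → y < n → S y → y ≺ x
      after : ∀ {y} → y < n → ¬ S y → y ≢ x → x ≺ y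
  open Next

  next : Prefix S p → toℕ i ≡ p → Next S (vertexAt i)
  next {S} {p} {i} pre i≡p = record
    { bounded = toℕ<n (lookup v i)
    ; fresh = λ placed → <-irrefl i≡p (from (pre i) placed)
    ; before = before′
    ; after = after′
    }
    where
    before′ : y < n → S y → y ≺ vertexAt i
    before′ y<n placed with position y<n
    ... | r , refl = r , i , refl , refl , subst (toℕ r <_) (sym i≡p) (from (pre r) placed)
    after′ : y < n → ¬ S y → y ≢ vertexAt i → vertexAt i ≺ y
    after′ y<n unplaced y≢ with position y<n
    ... | r , refl = i , r , refl , refl ,
          ≤∧≢⇒< (subst (_≤ toℕ r) (sym i≡p) (≮⇒≥ (unplaced ∘ to (pre r))))
                (λ e → y≢ (cong vertexAt (sym (toℕ-injective e))))

  module _ (n≢3 : n ≢ 3) (n≢4 : n ≢ 4) where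

    -- Such an x ≥ 2 is a backedge partner of 0 and of 3, 4 or 2 (for x = 2, 3, ≥ 4).
    no-early-large-vertex : (∀ {y} → y < n → y ≢ 1 → y ≢ x → x ≺ y) → x < n → ¬ 2 ≤ x
    no-early-large-vertex {2} later 2<n _
      with partners-unique (inj₁ (later (≤-trans (s≤s z≤n) 2<n) (λ ()) (λ ()) , inj₁ ≤-refl))
                           (inj₁ (later (≤∧≢⇒< 2<n (n≢3 ∘ sym)) (λ ()) (λ ()) , inj₂ refl))
    ... | ()
    no-early-large-vertex {3} later 3<n _
      with partners-unique (inj₁ (later (≤-trans (s≤s z≤n) 3<n) (λ ()) (λ ()) ,
                                  inj₁ (s≤s (s≤s z≤n))))
                           (inj₁ (later (≤∧≢⇒< 3<n (n≢4 ∘ sym)) (λ ()) (λ ()) , inj₂ refl))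
    ... | ()
    no-early-large-vertex {suc (suc (suc (suc k)))} later x<n _
      with partners-unique (inj₁ (later (≤-trans (s≤s z≤n) x<n) (λ ()) (λ ()) ,
                                  inj₁ (s≤s (s≤s z≤n))))
                           (inj₁ (later (≤-trans (s≤s (s≤s (s≤s z≤n))) x<n) (λ ()) (λ ()) ,
                                  inj₁ (s≤s (s≤s (s≤s (s≤s z≤n))))))
    ... | ()
    no-early-large-vertex {1} _ _ (s≤s ())

    first-vertex : Next (_< 0) x → x ≡ 0 ⊎ x ≡ 1
    first-vertex {x} nx with ≤-split (z≤n {x})
    ... | inj₁ x≡0 = inj₁ x≡0
    ... | inj₂ 1≤x with ≤-split 1≤x
    ...   | inj₁ x≡1 = inj₂ x≡1
    ...   | inj₂ 2≤x =
      ⊥-elim (no-early-large-vertex (λ y<n _ → after nx y<n (λ ())) (bounded nx) 2≤x)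

    next-up : Next (_< suc m) x → x ≡ partner n up (suc m)
    next-up {m} {x} nx with suc (suc m) <? n | ≤-split (≮⇒≥ (fresh nx))
    ... | no m+2≮n | _ =
      ≤-antisym (≤-pred (≤-trans (bounded nx) (≮⇒≥ m+2≮n))) (≮⇒≥ (fresh nx))
    ... | yes m+2<n | inj₁ refl =
      ⊥-elim (no-ascending-triple (before nx (<-trans (n<1+n m) (bounded nx)) (n<1+n m))
                       (after nx m+2<n (≤⇒≯ (n≤1+n (suc m))) (<⇒≢ (n<1+n (suc m)) ∘ sym)))
    ... | yes m+2<n | inj₂ m+2≤x with ≤-split m+2≤x
    ...   | inj₁ x≡m+2 = x≡m+2
    ...   | inj₂ m+3≤x =
      ⊥-elim (no-far-vertex-between (before nx (<-trans (n<1+n m) m+1<n) (n<1+n m))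
                      (after nx m+1<n (<-irrefl refl) (<⇒≢ (≤-trans (n≤1+n _) m+3≤x)))
                      m+3≤x)
      where
      m+1<n : suc m < n
      m+1<n = <-trans (n<1+n (suc m)) m+2<n

    next-down : Next (Placed down (suc m)) x → x ≡ m
    next-down {zero} {x} nx with ≤-split (z≤n {x})
    ... | inj₁ x≡0 = x≡0
    ... | inj₂ 1≤x with ≤-split 1≤x
    ...   | inj₁ refl = ⊥-elim (fresh nx (inj₂ refl))
    ...   | inj₂ 2≤x = ⊥-elim (no-early-large-vertex later (bounded nx) 2≤x)
      where
      later : y < n → y ≢ 1 → y ≢ x → x ≺ y
      later y<n y≢1 = after nx y<n λ { (inj₂ y≡1) → y≢1 y≡1 }
    next-down {suc k} {x} nx with ≤-split (≮⇒≥ (fresh nx ∘ inj₁))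
    ... | inj₁ x≡k+1 = x≡k+1
    ... | inj₂ k+2≤x with ≤-split k+2≤x
    ...   | inj₁ refl = ⊥-elim (fresh nx (inj₂ refl))
    ...   | inj₂ k+3≤x =
      ⊥-elim (no-far-vertex-between (before nx (<-trans (n<1+n k) k+1<n) (inj₁ (n<1+n k)))
                      (after nx k+1<n k+1-unplaced k+1≢x)
                      k+3≤x)
      where
      k+1≢x : suc k ≢ x
      k+1≢x = <⇒≢ (≤-trans (n≤1+n _) k+3≤x)
      k+1<n : suc k < n
      k+1<n = <-trans (≤-trans (n≤1+n _) k+3≤x) (bounded nx)
      k+1-unplaced : ¬ Placed down (suc (suc k)) (suc k)
      k+1-unplaced (inj₁ k+1<k+1) = <-irrefl refl k+1<k+1
      k+1-unplaced (inj₂ e) = <⇒≢ (n<1+n (suc k)) e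

    next-vertex : ∀ e → Next (Placed e (suc m)) x → x ≡ partner n e (suc m)
    next-vertex up = next-up
    next-vertex down = next-down

    module StartingWith (d : Dir) (first : ∀ {i} → toℕ i ≡ 0 → vertexAt i ≡ partner n d 0) where
      open Candidate n d using (π)

      prefix : ∀ p → p < n → Prefix (Placed (dirAt d p) p) p
      vertex-at : ∀ p → toℕ i ≡ p → vertexAt i ≡ π p

      prefix zero _ = empty-prefix d
      prefix (suc p) p+1<n =
        prefix-resp (λ {y} → placed-step {y = y} (dirAt d p) p+1<n)
                    (λ {y} → placed-step⁻ {y = y} (dirAt d p) p+1<n)
          (extend {S = Placed (dirAt d p) p} (prefix p p<n) (toℕ-fromℕ< p<n)
                  (vertex-at p (toℕ-fromℕ< p<n)))
        where
        p<n : p < n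
        p<n = <-trans (n<1+n p) p+1<n

      vertex-at zero i≡0 = first i≡0
      vertex-at {i} (suc m) i≡m+1 =
        next-vertex (dirAt d (suc m)) (next (prefix (suc m) (subst (_< n) i≡m+1 (toℕ<n i))) i≡m+1)

      is-candidate : v ≡ candidate n d
      is-candidate = trans (sym (tabulate∘lookup v)) (tabulate-cong λ i →
        toℕ-injective (trans (vertex-at (toℕ i) refl) (sym (toℕ-fromℕ< _))))

    matching-is-candidate : 2 ≤ n → v ≡ candidate n down ⊎ v ≡ candidate n up
    matching-is-candidate 2≤n =
      starting-with (first-vertex (next (empty-prefix up) (toℕ-fromℕ< 0<n)))
      where
      0<n : 0 < n
      0<n = ≤-trans (s≤s z≤n) 2≤n
      at-first : toℕ i ≡ 0 → vertexAt i ≡ vertexAt (fromℕ< 0<n)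
      at-first i≡0 = cong vertexAt (toℕ-injective (trans i≡0 (sym (toℕ-fromℕ< 0<n))))
      starting-with : vertexAt (fromℕ< 0<n) ≡ 0 ⊎ vertexAt (fromℕ< 0<n) ≡ 1 →
                      v ≡ candidate n down ⊎ v ≡ candidate n up
      starting-with (inj₁ v₀≡0) =
        inj₁ (StartingWith.is-candidate down λ i≡0 → trans (at-first i≡0) v₀≡0)
      starting-with (inj₂ v₀≡1) =
        inj₂ (StartingWith.is-candidate up λ i≡0 →
                trans (at-first i≡0) (trans v₀≡1 (sym (partner-up 2≤n))))

candidates-differ : ∀ k → candidate (2 + k) down ≢ candidate (2 + k) up
candidates-differ k e = 0≢1+n (begin
  0                                           ≡⟨ sym (Candidate.toℕ-lookup (2 + k) down (# 0)) ⟩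
  toℕ (lookup (candidate (2 + k) down) (# 0)) ≡⟨ cong (λ w → toℕ (lookup w (# 0))) e ⟩
  toℕ (lookup (candidate (2 + k) up) (# 0))   ≡⟨ Candidate.toℕ-lookup (2 + k) up (# 0) ⟩
  1                                           ∎)
  where open ≡-Reasoning

exactly-two : ∀ k → 2 + k ≢ 3 → 2 + k ≢ 4 → HasExactlyMatchingOrderings (P (2 + k)) 2
exactly-two k n≢3 n≢4 =
  candidates , refl , (candidates-differ k ∷ᵃ []ᵃ) ∷ᵖ []ᵃ ∷ᵖ []ᵖ ,
  λ v → mk⇔ listed-is-matching
            (λ mo → listed (Rigidity.matching-is-candidate v mo n≢3 n≢4 (s≤s (s≤s z≤n))))
  where
  candidates : List (Vec (Fin (2 + k)) (2 + k))
  candidates = candidate (2 + k) down ∷ˡ candidate (2 + k) up ∷ˡ []ˡ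
  listed : {v : Vec (Fin (2 + k)) (2 + k)} →
           v ≡ candidate (2 + k) down ⊎ v ≡ candidate (2 + k) up → v ∈ candidates
  listed (inj₁ e) = here e
  listed (inj₂ e) = there (here e)
  listed-is-matching : {v : Vec (Fin (2 + k)) (2 + k)} →
                       v ∈ candidates → IsMatchingOrdering (P (2 + k)) v
  listed-is-matching (here refl) = candidate-isMatchingOrdering (2 + k) down
  listed-is-matching (there (here refl)) = candidate-isMatchingOrdering (2 + k) up

edge? : ∀ a b → Dec (Edge a b)
edge? a b = (a + 2 ≤? b) ⊎-dec (a ℕ.≟ suc b)

isMatchingOrdering? : ∀ {n} (v : Vec (Fin n) n) → Dec (IsMatchingOrdering (P n) v)
isMatchingOrdering? {n} v =
  ((all? λ p → all? λ q → (lookup v p ≟ᶠ lookup v q) →-dec (p ≟ᶠ q))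
   ×-dec (all? λ x → any? λ p → lookup v p ≟ᶠ x))
  ×-dec (all? λ x → all? λ p → all? λ q → all? λ p′ → all? λ q′ →
           backedge? p q →-dec isEnd? x p q →-dec backedge? p′ q′ →-dec isEnd? x p′ q′ →-dec
           (p ≟ᶠ p′) ×-dec (q ≟ᶠ q′))
  where
  backedge? : ∀ p q → Dec (Backedge (P n) v p q)
  backedge? p q = (suc (toℕ p) ≤? toℕ q) ×-dec edge? (toℕ (lookup v q)) (toℕ (lookup v p))
  isEnd? : ∀ x p q → Dec (IsEnd v x p q)
  isEnd? x p q = (x ≟ᶠ lookup v p) ⊎-dec (x ≟ᶠ lookup v q)

all-vectors? : ∀ {n k} {Q : Vec (Fin n) k → Set} → (∀ v → Dec (Q v)) → Dec (∀ v → Q v)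
all-vectors? {k = zero} Q? = map′ (λ q → λ { [] → q }) (λ ∀q → ∀q []) (Q? [])
all-vectors? {k = suc k} Q? =
  map′ (λ ∀q → λ { (x ∷ v) → ∀q x v }) (λ ∀q x v → ∀q (x ∷ v))
       (all? λ x → all-vectors? λ v → Q? (x ∷ v))

module _ {n : ℕ} where
  open import Data.List.Membership.DecPropositional {A = Vec (Fin n) n} (≡-dec _≟ᶠ_) using (_∈?_)
  open import Data.List.Relation.Unary.Unique.DecPropositional {A = Vec (Fin n) n} (≡-dec _≟ᶠ_)
    using (unique?)

  enumerates-matching-orderings? : (xs : List (Vec (Fin n) n)) → Dec (∀ v → v ∈ xs ⇔ IsMatchingOrdering (P n) v)
  enumerates-matching-orderings? xs = all-vectors? λ v →
    map′ (λ (f , g) → mk⇔ f g) (λ e → to e , from e)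
         ((v ∈? xs →-dec isMatchingOrdering? v) ×-dec (isMatchingOrdering? v →-dec v ∈? xs))

  by-enumeration : (xs : List (Vec (Fin n) n)) → {True (unique? xs)} → {True (enumerates-matching-orderings? xs)} →
                   HasExactlyMatchingOrderings (P n) (length xs)
  by-enumeration xs {unique} {exact} = xs , refl , toWitness unique , toWitness exact

corollary5p6 : (HasExactlyMatchingOrderings (P 1) 1) ×
    (HasExactlyMatchingOrderings (P 3) 3) ×
    (HasExactlyMatchingOrderings (P 4) 3) ×
    (∀ (n : ℕ) → 2 ≤ n → n ≢ 3 → n ≢ 4 → HasExactlyMatchingOrderings (P n) 2)
corollary5p6 =
  by-enumeration ((# 0 ∷ []) ∷ˡ []ˡ) ,
  by-enumeration ((# 0 ∷ # 2 ∷ # 1 ∷ []) ∷ˡ (# 1 ∷ # 0 ∷ # 2 ∷ []) ∷ˡ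
                  (# 2 ∷ # 1 ∷ # 0 ∷ []) ∷ˡ []ˡ) ,
  by-enumeration ((# 0 ∷ # 2 ∷ # 1 ∷ # 3 ∷ []) ∷ˡ (# 1 ∷ # 0 ∷ # 3 ∷ # 2 ∷ []) ∷ˡ
                  (# 1 ∷ # 3 ∷ # 0 ∷ # 2 ∷ []) ∷ˡ []ˡ) ,
  λ { (suc (suc k)) _ → exactly-two k ; 1 (s≤s ()) }
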